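{- Define a sequence of positive integers $(a_n)_{n\ge 0}$ recursively by $a_0=4$ and, for $n\ge1$, $$a_n=\min\left\{\,\left|d-\frac{p_n}{d}\right| \;:\; d \text{ a positive divisor of } p_n,\ \left|d-\frac{p_n}{d}\right|>1\right\},\qquad\text{where } p_n=\prod_{k=0}^{n-1}a_k .$$ Define $(b_n)_{n\ge1}$ by $b_1=1$ and $b_n=\left\lceil \tfrac12\sum_{k=1}^{n-1} b_k\right\rceil$ for $n\ge2$. Then $a_n=2^{b_n}$ for all $n>2$.
   Context: The first terms are $a_0,a_1,\dots=4,3,4,2,4,8,16,64,\dots$ and $b_1,b_2,\dots=1,1,1,2,3,4,6,9,14,\dots$. -}

module Defs where

open import Data.Nat.Base using (ℕ; zero; suc; _+_; _*_; _<_; _≤_; ⌈_/2⌉; ∣_-_∣)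
open import Data.Nat.Divisibility using (_∣_)
open import Data.Product using (Σ; ∃; _×_; _,_)
open import Relation.Binary.PropositionalEquality using (_≡_)

prodUpTo : (ℕ → ℕ) → ℕ → ℕ
prodUpTo a zero    = 1
prodUpTo a (suc n) = prodUpTo a n * a n

-- m ∈ { |d - p/d| : d a positive divisor of p, |d - p/d| > 1 }
-- (p/d written as the cofactor q with d * q ≡ p)
Candidate : ℕ → ℕ → Set
Candidate p m = ∃ λ d → ∃ λ q → 0 < d × d * q ≡ p × m ≡ ∣ d - q ∣ × 1 < m

IsMinCandidate : ℕ → ℕ → Set
IsMinCandidate p m = Candidate p m × (∀ m′ → Candidate p m′ → m ≤ m′)

IsASeq : (ℕ → ℕ) → Set
IsASeq a = a 0 ≡ 4 × (∀ n → IsMinCandidate (prodUpTo a (suc n)) (a (suc n)))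

-- b 1 = 1, b n = ⌈ (1/2) Σ_{k=1}^{n-1} b k ⌉ for n ≥ 2; b 0 = 0 is an unused convention.
-- sumB m = Σ_{k=1}^{m} b k
mutual
  b : ℕ → ℕ
  b zero = 0
  b (suc zero) = 1
  b (suc (suc n)) = ⌈ sumB (suc n) /2⌉

  sumB : ℕ → ℕ
  sumB zero = 0
  sumB (suc n) = sumB n + b (suc n)

-- For N ≥ 3 the partial product p_N is 3·2^(n+2) with n = b₁ + … + b_{N-1}
-- (starting from p₃ = 4·3·4 = 3·2⁴).  Write n + 2 = 2k + r with r ∈ {1,2}, so
-- k = ⌈n/2⌉ ≥ 1.  The factorisation 2^r·2^k × 3·2^k of p has gap 2^k > 1, and no
-- factorisation has a smaller gap: if both factors are even, halve them (k drops
-- by one); if one is odd, it divides 3, so the other is at least 2^(2k+r) and the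
-- gap is at least 2^(2k+r) − 3 ≥ 2^k; and for k = 0 the gap is nonzero because 6
-- and 12 are not squares.  Hence a_N = 2^⌈n/2⌉ = 2^{b_N}, and
-- p_{N+1} = 3·2^(n+2+b_N) has the same form.

module Submission where

open import Defs
open import Data.Nat.Base
  using (ℕ; zero; suc; _+_; _*_; _^_; _<_; _≤_; z≤n; s≤s; z<s; s<s; NonZero; ⌈_/2⌉; ∣_-_∣)
open import Data.Nat.Properties
open import Data.Nat.Divisibility using (_∣_; divides; _∣?_; ∣⇒≤; m∣m*n)
open import Data.Nat.Coprimality using (Coprime; coprime-divisor)
open import Data.Nat.Primality using (prime[2]; prime⇒irreducible)
open import Data.Nat.Tactic.RingSolver using (solve; solve-∀)
open import Data.Product using (∃; _×_; _,_; proj₁; proj₂)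
open import Data.Sum using (inj₁; inj₂)
open import Data.Unit using (tt)
open import Data.List.Base using ([]; _∷_)
open import Relation.Nullary using (¬_; yes; no; contradiction)
open import Relation.Nullary.Decidable using (Dec; toWitness; _→-dec_)
open import Relation.Binary.PropositionalEquality
  using (_≡_; _≢_; refl; sym; trans; cong; cong₂; subst; subst₂; module ≡-Reasoning)

isMinCandidate-unique : ∀ {p m m′} → IsMinCandidate p m → IsMinCandidate p m′ → m ≡ m′
isMinCandidate-unique (cm , m-min) (cm′ , m′-min) = ≤-antisym (m-min _ cm′) (m′-min _ cm)

LowerBound : ℕ → ℕ → Set
LowerBound p c = ∀ m → Candidate p m → c ≤ m

GapsBoundedBelow : ℕ → ℕ → Set
GapsBoundedBelow p c =
  ∀ {d} → d < suc p → ∀ {q} → q < suc p → d * q ≡ p → 1 < ∣ d - q ∣ → c ≤ ∣ d - q ∣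

gapsBoundedBelow? : ∀ p c → Dec (GapsBoundedBelow p c)
gapsBoundedBelow? p c = allUpTo? (λ d → allUpTo? (λ q →
  (d * q ≟ p) →-dec ((1 <? ∣ d - q ∣) →-dec (c ≤? ∣ d - q ∣))) (suc p)) (suc p)

m*n≡o⇒m≤o : ∀ {p} .{{_ : NonZero p}} d q → d * q ≡ p → d ≤ p
m*n≡o⇒m≤o d q refl = ∣⇒≤ (m∣m*n q)

gapsBoundedBelow⇒lowerBound : ∀ {p c} .{{_ : NonZero p}} → GapsBoundedBelow p c → LowerBound p c
gapsBoundedBelow⇒lowerBound bounded _ (d , q , _ , dq≡p , refl , 1<m) =
  bounded (s≤s (m*n≡o⇒m≤o d q dq≡p)) (s≤s (m*n≡o⇒m≤o q d (trans (*-comm q d) dq≡p))) dq≡p 1<m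

minCandidate[4]≡3 : IsMinCandidate 4 3
minCandidate[4]≡3 = (1 , 4 , z<s , refl , refl , s<s z<s)
  , gapsBoundedBelow⇒lowerBound (toWitness {a? = gapsBoundedBelow? 4 3} tt)

minCandidate[12]≡4 : IsMinCandidate 12 4
minCandidate[12]≡4 = (2 , 6 , z<s , refl , refl , s<s z<s)
  , gapsBoundedBelow⇒lowerBound (toWitness {a? = gapsBoundedBelow? 12 4} tt)

non-square-between : ∀ {n m} → n * n < m → m < suc n * suc n → ∀ d → d * d ≢ m
non-square-between {n} lo hi d refl with ≤-<-connex d n
... | inj₁ d≤n = <⇒≱ lo (*-mono-≤ d≤n d≤n)
... | inj₂ n<d = <⇒≱ hi (*-mono-≤ n<d n<d)

non-square⇒0<∣d-q∣ : ∀ {m} → (∀ d → d * d ≢ m) → ∀ d q → d * q ≡ m → 0 < ∣ d - q ∣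
non-square⇒0<∣d-q∣ {m} non-square d q dq≡m = n≢0⇒n>0 λ gap≡0 →
  non-square d (subst (λ x → d * x ≡ m) (sym (∣m-n∣≡0⇒m≡n gap≡0)) dq≡m)

odd⇒coprime-2 : ∀ {d} → ¬ 2 ∣ d → Coprime d 2
odd⇒coprime-2 2∤d (i∣d , i∣2) with prime⇒irreducible prime[2] i∣2
... | inj₁ i≡1  = i≡1
... | inj₂ refl = contradiction i∣d 2∤d

odd∣2^e*m⇒∣m : ∀ {d m} e → ¬ 2 ∣ d → d ∣ 2 ^ e * m → d ∣ m
odd∣2^e*m⇒∣m {d} {m} zero    _   d∣m = subst (d ∣_) (*-identityˡ m) d∣m
odd∣2^e*m⇒∣m {d} {m} (suc e) 2∤d d∣  =
  odd∣2^e*m⇒∣m e 2∤d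
    (coprime-divisor (odd⇒coprime-2 2∤d) (subst (d ∣_) (*-assoc 2 (2 ^ e) m) d∣))

m+n≤o⇒m≤∣n-o∣ : ∀ {y d q} → y + d ≤ q → y ≤ ∣ d - q ∣
m+n≤o⇒m≤∣n-o∣ {y} {d} {q} y+d≤q =
  subst (y ≤_) (sym (m≤n⇒∣m-n∣≡n∸m (≤-trans (m≤n+m d y) y+d≤q))) (m+n≤o⇒m≤o∸n y y+d≤q)

odd-factor-gap : ∀ {y e d q} → ¬ 2 ∣ d → d * q ≡ 3 * 2 ^ e → y + 3 ≤ 2 ^ e → y ≤ ∣ d - q ∣
odd-factor-gap {y} {e} {d} {q} 2∤d dq≡3·2^e room = m+n≤o⇒m≤∣n-o∣ (begin
  y + d     ≤⟨ +-monoʳ-≤ y d≤3 ⟩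
  y + 3     ≤⟨ room ⟩
  2 ^ e     ≤⟨ *-cancelˡ-≤ 3 3·2^e≤3q ⟩
  q         ∎)
  where
  open ≤-Reasoning
  d≤3 : d ≤ 3
  d≤3 = ∣⇒≤ (odd∣2^e*m⇒∣m e 2∤d (subst (d ∣_) (trans dq≡3·2^e (*-comm 3 (2 ^ e))) (m∣m*n q)))
  3·2^e≤3q : 3 * 2 ^ e ≤ 3 * q
  3·2^e≤3q = subst (_≤ 3 * q) dq≡3·2^e (*-monoˡ-≤ q d≤3)

2^[1+k]+3≤2^[1+k+1+k+r] : ∀ k {r} → 1 ≤ r → 2 ^ suc k + 3 ≤ 2 ^ (suc k + suc k + r)
2^[1+k]+3≤2^[1+k+1+k+r] k {r} 1≤r = begin
  2 ^ suc k + 3          ≤⟨ +-monoʳ-≤ (2 ^ suc k) (*-monoʳ-≤ 3 (m^n>0 2 (suc k))) ⟩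
  4 * 2 ^ suc k          ≡⟨ *-assoc 2 2 (2 ^ suc k) ⟩
  2 ^ (2 + suc k)        ≡⟨ cong (2 ^_) (+-comm 2 (suc k)) ⟩
  2 ^ (suc k + 2)        ≤⟨ ^-monoʳ-≤ 2 (+-monoʳ-≤ (suc k) (s≤s (≤-trans 1≤r (m≤n+m r k)))) ⟩
  2 ^ (suc k + (suc k + r)) ≡⟨ cong (2 ^_) (+-assoc (suc k) (suc k) r) ⟨
  2 ^ (suc k + suc k + r) ∎
  where open ≤-Reasoning

factor-gap≥2^k : ∀ k {r} → 1 ≤ r → r ≤ 2 →
                 ∀ d q → d * q ≡ 3 * 2 ^ (k + k + r) → 2 ^ k ≤ ∣ d - q ∣
factor-gap≥2^k zero (s≤s z≤n) (s≤s z≤n) d q dq≡6 =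
  non-square⇒0<∣d-q∣ (non-square-between {2} (m≤m+n 5 1) (m≤m+n 7 2)) d q dq≡6
factor-gap≥2^k zero (s≤s z≤n) (s≤s (s≤s z≤n)) d q dq≡12 =
  non-square⇒0<∣d-q∣ (non-square-between {3} (m≤m+n 10 2) (m≤m+n 13 3)) d q dq≡12
factor-gap≥2^k (suc k) {r} 1≤r r≤2 d q dq≡ with 2 ∣? d | 2 ∣? q
... | no 2∤d | _      =
  odd-factor-gap {e = suc k + suc k + r} 2∤d dq≡ (2^[1+k]+3≤2^[1+k+1+k+r] k 1≤r)
... | yes _  | no 2∤q = subst (2 ^ suc k ≤_) (∣-∣-comm q d)
  (odd-factor-gap {e = suc k + suc k + r} 2∤q (trans (*-comm q d) dq≡)
    (2^[1+k]+3≤2^[1+k+1+k+r] k 1≤r))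
... | yes (divides d′ refl) | yes (divides q′ refl) = begin
  2 ^ suc k             ≤⟨ *-monoʳ-≤ 2 (factor-gap≥2^k k 1≤r r≤2 d′ q′ d′q′≡) ⟩
  2 * ∣ d′ - q′ ∣       ≡⟨ *-comm 2 ∣ d′ - q′ ∣ ⟩
  ∣ d′ - q′ ∣ * 2       ≡⟨ *-distribʳ-∣-∣ 2 d′ q′ ⟩
  ∣ d′ * 2 - q′ * 2 ∣   ∎
  where
  open ≤-Reasoning
  X : ℕ
  X = 2 ^ (k + k + r)
  d′q′≡ : d′ * q′ ≡ 3 * X
  d′q′≡ = *-cancelʳ-≡ (d′ * q′) (3 * X) 4 (begin-equality
    d′ * q′ * 4                     ≡⟨ solve (d′ ∷ q′ ∷ []) ⟩
    d′ * 2 * (q′ * 2)               ≡⟨ dq≡ ⟩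
    3 * 2 ^ (suc k + suc k + r)     ≡⟨ cong (λ e → 3 * 2 ^ suc (e + r)) (+-suc k k) ⟩
    3 * (2 * (2 * X))               ≡⟨ cong (3 *_) (*-assoc 2 2 X) ⟨
    3 * (4 * X)                     ≡⟨ cong (3 *_) (*-comm 4 X) ⟩
    3 * (X * 4)                     ≡⟨ *-assoc 3 X 4 ⟨
    3 * X * 4                       ∎)

∣2^r-3∣≡1 : ∀ {r} → 1 ≤ r → r ≤ 2 → ∣ 2 ^ r - 3 ∣ ≡ 1
∣2^r-3∣≡1 (s≤s z≤n) (s≤s z≤n)       = refl
∣2^r-3∣≡1 (s≤s z≤n) (s≤s (s≤s z≤n)) = refl

2^k-candidate : ∀ k {r} → 1 ≤ k → 1 ≤ r → r ≤ 2 → Candidate (3 * 2 ^ (k + k + r)) (2 ^ k)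
2^k-candidate k {r} 1≤k 1≤r r≤2 =
  2 ^ r * X , 3 * X , *-mono-≤ (m^n>0 2 r) (m^n>0 2 k) , product , sym gap
  , ^-monoʳ-< 2 (s≤s (s≤s z≤n)) 1≤k
  where
  open ≡-Reasoning
  X : ℕ
  X = 2 ^ k
  rearrange : ∀ x y → y * x * (3 * x) ≡ 3 * (x * x * y)
  rearrange = solve-∀
  product : 2 ^ r * X * (3 * X) ≡ 3 * 2 ^ (k + k + r)
  product = begin
    2 ^ r * X * (3 * X)       ≡⟨ rearrange X (2 ^ r) ⟩
    3 * (X * X * 2 ^ r)       ≡⟨ cong (λ y → 3 * (y * 2 ^ r)) (^-distribˡ-+-* 2 k k) ⟨
    3 * (2 ^ (k + k) * 2 ^ r) ≡⟨ cong (3 *_) (^-distribˡ-+-* 2 (k + k) r) ⟨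
    3 * 2 ^ (k + k + r)       ∎
  gap : ∣ 2 ^ r * X - 3 * X ∣ ≡ X
  gap = begin
    ∣ 2 ^ r * X - 3 * X ∣ ≡⟨ *-distribʳ-∣-∣ X (2 ^ r) 3 ⟨
    ∣ 2 ^ r - 3 ∣ * X     ≡⟨ cong (_* X) (∣2^r-3∣≡1 1≤r r≤2) ⟩
    1 * X                 ≡⟨ *-identityˡ X ⟩
    X                     ∎

2+n≡⌈n/2⌉+⌈n/2⌉+r : ∀ n → ∃ λ r → 1 ≤ r × r ≤ 2 × 2 + n ≡ ⌈ n /2⌉ + ⌈ n /2⌉ + r
2+n≡⌈n/2⌉+⌈n/2⌉+r zero = 2 , s≤s z≤n , ≤-refl , refl
2+n≡⌈n/2⌉+⌈n/2⌉+r (suc zero) = 1 , s≤s z≤n , s≤s z≤n , refl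
2+n≡⌈n/2⌉+⌈n/2⌉+r (suc (suc n)) with 2+n≡⌈n/2⌉+⌈n/2⌉+r n
... | r , 1≤r , r≤2 , split = r , 1≤r , r≤2 , cong suc (begin
  3 + n                         ≡⟨ cong suc split ⟩
  suc ⌈ n /2⌉ + ⌈ n /2⌉ + r     ≡⟨ cong (_+ r) (+-suc ⌈ n /2⌉ ⌈ n /2⌉) ⟨
  ⌈ n /2⌉ + suc ⌈ n /2⌉ + r     ∎)
  where open ≡-Reasoning

minCandidate[3·2^[2+n]]≡2^⌈n/2⌉ : ∀ n → 1 ≤ n → IsMinCandidate (3 * 2 ^ (2 + n)) (2 ^ ⌈ n /2⌉)
minCandidate[3·2^[2+n]]≡2^⌈n/2⌉ n 1≤n with 2+n≡⌈n/2⌉+⌈n/2⌉+r n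
... | r , 1≤r , r≤2 , split = subst (λ e → IsMinCandidate (3 * 2 ^ e) (2 ^ k)) (sym split)
  ( 2^k-candidate k (⌈n/2⌉-mono 1≤n) 1≤r r≤2
  , λ { _ (d , q , _ , dq≡ , refl , _) → factor-gap≥2^k k 1≤r r≤2 d q dq≡ })
  where
  k : ℕ
  k = ⌈ n /2⌉

1≤sumB[1+n] : ∀ n → 1 ≤ sumB (suc n)
1≤sumB[1+n] zero    = ≤-refl
1≤sumB[1+n] (suc n) = ≤-trans (1≤sumB[1+n] n) (m≤m+n (sumB (suc n)) (b (suc (suc n))))

module _ {a : ℕ → ℕ} (isA : IsASeq a) where

  a₁≡3 : a 1 ≡ 3
  a₁≡3 = isMinCandidate-unique
    (subst (λ x → IsMinCandidate (1 * x) (a 1)) (proj₁ isA) (proj₂ isA 0)) minCandidate[4]≡3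

  a₂≡4 : a 2 ≡ 4
  a₂≡4 = isMinCandidate-unique
    (subst₂ (λ x y → IsMinCandidate (1 * x * y) (a 2)) (proj₁ isA) a₁≡3 (proj₂ isA 1))
    minCandidate[12]≡4

  a[3+t]≡2^b[3+t] : ∀ t → prodUpTo a (3 + t) ≡ 3 * 2 ^ (2 + sumB (2 + t)) →
                    a (3 + t) ≡ 2 ^ b (3 + t)
  a[3+t]≡2^b[3+t] t prod≡ = isMinCandidate-unique
    (subst (λ p → IsMinCandidate p (a (3 + t))) prod≡ (proj₂ isA (2 + t)))
    (minCandidate[3·2^[2+n]]≡2^⌈n/2⌉ (sumB (2 + t)) (1≤sumB[1+n] (suc t)))

  prodUpTo[3+t] : ∀ t → prodUpTo a (3 + t) ≡ 3 * 2 ^ (2 + sumB (2 + t))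
  prodUpTo[3+t] zero rewrite proj₁ isA | a₁≡3 | a₂≡4 = refl
  prodUpTo[3+t] (suc t) = begin
    prodUpTo a (3 + t) * a (3 + t)       ≡⟨ cong₂ _*_ prod≡ (a[3+t]≡2^b[3+t] t prod≡) ⟩
    3 * 2 ^ (2 + S) * 2 ^ b (3 + t)      ≡⟨ *-assoc 3 (2 ^ (2 + S)) (2 ^ b (3 + t)) ⟩
    3 * (2 ^ (2 + S) * 2 ^ b (3 + t))    ≡⟨ cong (3 *_) (^-distribˡ-+-* 2 (2 + S) (b (3 + t))) ⟨
    3 * 2 ^ (2 + S + b (3 + t))          ∎
    where
    open ≡-Reasoning
    S : ℕ
    S = sumB (2 + t)
    prod≡ : prodUpTo a (3 + t) ≡ 3 * 2 ^ (2 + S)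
    prod≡ = prodUpTo[3+t] t

theorem1 : (a : ℕ → ℕ) → IsASeq a → ∀ n → 2 < n → a n ≡ 2 ^ b n
theorem1 a isA (suc (suc (suc t))) _ = a[3+t]≡2^b[3+t] isA t (prodUpTo[3+t] isA t)
theorem1 _ _ 1 (s<s ())
theorem1 _ _ 2 (s<s (s<s ()))
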